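{- Let $G=K_n$ be the complete graph of order $n\geq 3$, let $G_1,G_2$ be disjoint copies of $G$ with $A=V(G_1)$, $B=V(G_2)$, let $g:A\to B$ be a function, and let $s=|g(A)|$ with $2<s<n$. If there are $n-s+1$ vertices of $A$ that all have the same image under $g$, then $fix(F_G)=2n-(s+3)$.
   Context: A set $S\subseteq V(H)$ is a fixing set of a graph $H$ if the only automorphism of $H$ fixing every vertex of $S$ is the identity; $fix(H)$ is the minimum cardinality of a fixing set of $H$. Functigraph: for disjoint copies $G_1,G_2$ of $G$, $A=V(G_1)$, $B=V(G_2)$ and a function $g:A\to B$, $F_G$ is the graph with vertex set $A\cup B$ and edge set $E(G_1)\cup E(G_2)\cup\{uv:u\in A,\ v=g(u)\}$. -}

module Defs where

open import Data.Nat using (ℕ; _≤_)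
open import Data.Fin using (Fin; _≟_)
open import Data.Fin.Properties using (any?)
open import Data.Sum using (_⊎_; inj₁; inj₂)
open import Data.List using (List; length; filter; allFin)
open import Data.List.Membership.Propositional using (_∈_)
open import Data.List.Relation.Unary.Unique.Propositional using (Unique)
open import Data.Product using (Σ; _×_; ∃-syntax)
open import Data.Empty using (⊥)
open import Relation.Nullary using (¬_)
open import Relation.Binary.PropositionalEquality using (_≡_)

record Graph (V : Set) : Set₁ where
  field
    Adj : V → V → Set

open Graph public

K : (n : ℕ) → Graph (Fin n)
Adj (K n) i j = ¬ (i ≡ j)

-- Functigraph F_G: vertices A ⊎ B (inj₁ = copy G₁ = A, inj₂ = copy G₂ = B),
-- edges of both copies plus edges u g(u) for u ∈ A (undirected).
FAdj : {n : ℕ} → Graph (Fin n) → (Fin n → Fin n) → Fin n ⊎ Fin n → Fin n ⊎ Fin n → Set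
FAdj G g (inj₁ x) (inj₁ y) = Adj G x y
FAdj G g (inj₂ x) (inj₂ y) = Adj G x y
FAdj G g (inj₁ a) (inj₂ b) = g a ≡ b
FAdj G g (inj₂ b) (inj₁ a) = g a ≡ b

Functigraph : {n : ℕ} → Graph (Fin n) → (Fin n → Fin n) → Graph (Fin n ⊎ Fin n)
Adj (Functigraph G g) = FAdj G g

record Automorphism {V : Set} (H : Graph V) : Set where
  field
    fun : V → V
    inv : V → V
    inv-left : ∀ v → inv (fun v) ≡ v
    inv-right : ∀ v → fun (inv v) ≡ v
    preserves : ∀ u v → (Adj H u v → Adj H (fun u) (fun v)) × (Adj H (fun u) (fun v) → Adj H u v)

open Automorphism public

IsFixingSet : {V : Set} → Graph V → List V → Set
IsFixingSet H S = (σ : Automorphism H) → (∀ v → v ∈ S → fun σ v ≡ v) → ∀ v → fun σ v ≡ v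

-- fix(H) = k: k is the minimum cardinality of a fixing set (sets = duplicate-free lists).
FixNumber : {V : Set} → Graph V → ℕ → Set
FixNumber H k =
  (∃[ S ] (Unique S × IsFixingSet H S × length S ≡ k)) ×
  (∀ S → Unique S → IsFixingSet H S → k ≤ length S)

imageSize : {n : ℕ} → (Fin n → Fin n) → ℕ
imageSize {n} g = length (filter (λ b → any? (λ a → g a ≟ b)) (allFin n))

fibreSize : {n : ℕ} → (Fin n → Fin n) → Fin n → ℕ
fibreSize {n} g b = length (filter (λ a → g a ≟ b) (allFin n))

module Submission where

-- Counting: the fibre g⁻¹(b) and one chosen preimage of each of the other s − 1
-- image points are distinct points of A, so every fibre other than g⁻¹(b) is a
-- singleton {pre y}.  The vertices of F then fall into "twin classes" of three
-- kinds: a single vertex of g⁻¹(b), a single vertex of B ∖ g(A), or a pair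
-- {pre y, y} with y ∈ g(A) ∖ {b}.  Any two classes of one kind are exchanged by an
-- automorphism induced by transpositions of A and B intertwining g, which fixes
-- every other vertex; hence a fixing set meets all but at most one class of each
-- kind, and |S| ≥ (n − s) + (n − s − 1) + (s − 2) = 2n − (s + 3).
-- Conversely, A minus one point of g⁻¹(b) and one preimage of another image point,
-- together with B ∖ g(A) minus one point, has this size and is a fixing set: the
-- remaining vertices are forced one after another through adjacencies.

open import Defs
open import Data.Nat using (ℕ; _+_; _*_; _∸_; _≤_; _<_)
open import Relation.Binary.PropositionalEquality using (_≡_)
open import Data.Fin using (Fin)
open import Data.Product using (∃-syntax)

open import Data.Nat using (suc; z≤n; s≤s; s≤s⁻¹)
open import Data.Nat.Properties
  using (≤-trans; ≤-reflexive; +-mono-≤; +-monoˡ-≤; +-monoʳ-≤; +-comm; +-suc; m≤n+m; <-irrefl;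
         m+n∸n≡m; m+n∸m≡n; n<1+n; m∸n+n≡m; m≤n+o⇒m∸n≤o; m<n⇒0<n∸m; +-cancelˡ-≤; module ≤-Reasoning)
open import Data.Nat.Tactic.RingSolver using (solve-∀)
open import Data.Fin using (_≟_)
open import Data.Fin.Properties using (any?)
open import Data.Fin.Permutation using (Permutation′; _⟨$⟩ʳ_; _⟨$⟩ˡ_; inverseˡ; inverseʳ; transpose; id)
open import Data.List using (List; []; _∷_; length; filter; map; _++_; concatMap; allFin)
open import Data.List.Properties using (length-++; length-++-sucʳ; length-map; length-tabulate; length-filter;
                                        filter-++; filter-accept; filter-reject; filter-all)
open import Data.List.Membership.Propositional using (_∈_; _∉_; find; lose)
open import Data.List.Membership.Propositional.Properties
  using (∈-++⁻; ∈-++⁺ˡ; ∈-++⁺ʳ; ∈-∃++; ∈-map⁺; ∈-map⁻; ∈-filter⁺; ∈-filter⁻; ∈-allFin; ∈-concatMap⁻)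
open import Data.List.Relation.Unary.Any using (Any; here; there)
import Data.List.Relation.Unary.Any as Any
import Data.List.Relation.Unary.Any.Properties as Any
open import Data.List.Relation.Unary.All as All using (All; []; _∷_)
open import Data.List.Relation.Unary.AllPairs using ([]; _∷_)
open import Data.List.Relation.Unary.Unique.Propositional using (Unique)
open import Data.List.Relation.Unary.Unique.Propositional.Properties using (++⁺; map⁺; filter⁺; allFin⁺)
import Data.List.Membership.DecPropositional as DecMembership
open import Data.Product using (Σ; _×_; _,_; proj₁; proj₂)
open import Data.Sum using (_⊎_; inj₁; inj₂) renaming (map to ⊎-map)
open import Data.Sum.Properties using (inj₁-injective; inj₂-injective; ≡-dec)
open import Data.Empty using (⊥-elim)
open import Relation.Nullary using (¬_; Dec; yes; no; ¬?)
open import Relation.Nullary.Decidable using (decidable-stable)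
open import Relation.Unary using (Pred; Decidable)
open import Level using (0ℓ)
open import Relation.Binary.Definitions using (DecidableEquality)
open import Relation.Binary.PropositionalEquality using (_≢_; refl; sym; trans; cong; cong₂; subst; module ≡-Reasoning)

module _ {A : Set} where

  unique-⊆-length : ∀ {W L : List A} → Unique W → (∀ {x} → x ∈ W → x ∈ L) → length W ≤ length L
  unique-⊆-length {[]} _ _ = z≤n
  unique-⊆-length {w ∷ W} (w∉W ∷ uW) W⊆L with ∈-∃++ (W⊆L (here refl))
  ... | xs , ys , refl = begin
      suc (length W)          ≤⟨ s≤s (unique-⊆-length uW W⊆xs++ys) ⟩
      suc (length (xs ++ ys)) ≡⟨ length-++-sucʳ xs w ys ⟨
      length (xs ++ w ∷ ys)   ∎
    where
    open ≤-Reasoning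
    -- the rest of W avoids w, so it survives the deletion of w
    W⊆xs++ys : ∀ {x} → x ∈ W → x ∈ xs ++ ys
    W⊆xs++ys x∈W with ∈-++⁻ xs (W⊆L (there x∈W))
    ... | inj₁ x∈xs          = ∈-++⁺ˡ x∈xs
    ... | inj₂ (here x≡w)    = ⊥-elim (All.lookup w∉W x∈W (sym x≡w))
    ... | inj₂ (there x∈ys)  = ∈-++⁺ʳ xs x∈ys

  map-unique-on : ∀ {B : Set} (f : A → B) {L : List A} →
                  (∀ {x y} → x ∈ L → y ∈ L → f x ≡ f y → x ≡ y) → Unique L → Unique (map f L)
  map-unique-on f {[]} _ _ = []
  map-unique-on f {x ∷ L} inj (x∉L ∷ uL) =
    All.tabulate fx∉ ∷ map-unique-on f (λ p q → inj (there p) (there q)) uL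
    where
    fx∉ : ∀ {v} → v ∈ map f L → f x ≢ v
    fx∉ v∈ fx≡v with ∈-map⁻ f v∈
    ... | z , z∈L , refl = All.lookup x∉L z∈L (inj (here refl) (there z∈L) fx≡v)

  some-member : (L : List A) → 1 ≤ length L → Σ A (_∈ L)
  some-member (x ∷ _) _ = x , here refl

  two-members : (L : List A) → Unique L → 2 ≤ length L → Σ A λ x → Σ A λ y → x ∈ L × y ∈ L × x ≢ y
  two-members (x ∷ y ∷ _) ((x≢y ∷ _) ∷ _) _ = x , y , here refl , there (here refl) , x≢y
  two-members (_ ∷ []) _ (s≤s ())

  member-length : ∀ {x} {L : List A} → x ∈ L → 1 ≤ length L
  member-length {L = _ ∷ _} _ = s≤s z≤n

  concatMap-unique : ∀ {I : Set} (part : I → List A) (classOf : A → I) {L : List I} →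
                     (∀ {x v} → x ∈ L → v ∈ part x → classOf v ≡ x) →
                     (∀ {x} → x ∈ L → Unique (part x)) → Unique L → Unique (concatMap part L)
  concatMap-unique part classOf {[]} _ _ _ = []
  concatMap-unique part classOf {x ∷ L} class unique-part (x∉L ∷ uL) =
    ++⁺ (unique-part (here refl))
        (concatMap-unique part classOf (λ p → class (there p)) (λ p → unique-part (there p)) uL)
        disjoint
    where
    disjoint : ∀ {v} → ¬ (v ∈ part x × v ∈ concatMap part L)
    disjoint (v∈x , v∈L) with find (∈-concatMap⁻ part v∈L)
    ... | y , y∈L , v∈y = All.lookup x∉L y∈L (trans (sym (class (here refl) v∈x)) (class (there y∈L) v∈y))

module _ {A : Set} {P : Pred A 0ℓ} (P? : Decidable P) where

  length-filter-++ : ∀ xs ys → length (filter P? (xs ++ ys)) ≡ length (filter P? xs) + length (filter P? ys)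
  length-filter-++ xs ys = trans (cong length (filter-++ P? xs ys)) (length-++ (filter P? xs))

  length-filter-map : ∀ {B : Set} (f : B → A) L → length (filter P? (map f L)) ≡ length (filter (λ x → P? (f x)) L)
  length-filter-map f [] = refl
  length-filter-map f (x ∷ L) with P? (f x)
  ... | yes _ = cong suc (length-filter-map f L)
  ... | no _  = length-filter-map f L

  length-filter-split : ∀ L → length (filter P? L) + length (filter (λ x → ¬? (P? x)) L) ≡ length L
  length-filter-split [] = refl
  length-filter-split (x ∷ L) with P? x
  ... | yes _ = cong suc (length-filter-split L)
  ... | no _  = trans (+-suc _ _) (cong suc (length-filter-split L))

  pairwise-cover-length : ∀ L → Unique L → (∀ {x y} → x ∈ L → y ∈ L → x ≢ y → P x ⊎ P y) →
                          length L ≤ suc (length (filter P? L))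
  pairwise-cover-length [] _ _ = z≤n
  pairwise-cover-length (x ∷ L) (x∉L ∷ uL) cover with P? x
  ... | yes _  = s≤s (pairwise-cover-length L uL (λ p q → cover (there p) (there q)))
  ... | no ¬px = s≤s (≤-reflexive (cong length (sym (filter-all P? (All.tabulate rest)))))
    where
    rest : ∀ {z} → z ∈ L → P z
    rest z∈L with cover (here refl) (there z∈L) (All.lookup x∉L z∈L)
    ... | inj₁ px = ⊥-elim (¬px px)
    ... | inj₂ pz = pz

  count-parts : ∀ {I : Set} (part : I → List A) L →
                length (filter (λ x → Any.any? P? (part x)) L) ≤ length (filter P? (concatMap part L))
  count-parts part [] = z≤n
  count-parts part (x ∷ L) with Any.any? P? (part x)
  ... | yes hit = begin
      1 + length (filter _ L)                                         ≤⟨ +-mono-≤ (nonempty hit) (count-parts part L) ⟩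
      length (filter P? (part x)) + length (filter P? (concatMap part L)) ≡⟨ length-filter-++ (part x) _ ⟨
      length (filter P? (concatMap part (x ∷ L)))                     ∎
    where
    open ≤-Reasoning
    nonempty : Any P (part x) → 1 ≤ length (filter P? (part x))
    nonempty p with find p
    ... | _ , y∈ , py = member-length (∈-filter⁺ P? y∈ py)
  ... | no _ = begin
      length (filter _ L)                                             ≤⟨ count-parts part L ⟩
      length (filter P? (concatMap part L))                           ≤⟨ m≤n+m _ _ ⟩
      length (filter P? (part x)) + length (filter P? (concatMap part L)) ≡⟨ length-filter-++ (part x) _ ⟨
      length (filter P? (concatMap part (x ∷ L)))                     ∎
    where open ≤-Reasoning

module _ {A : Set} (_≟_ : DecidableEquality A) where

  remove : A → List A → List A
  remove x = filter (λ z → ¬? (z ≟ x))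

  ∈-remove⁺ : ∀ {x y L} → x ∈ L → x ≢ y → x ∈ remove y L
  ∈-remove⁺ {y = y} = ∈-filter⁺ (λ z → ¬? (z ≟ y))

  ∈-remove⁻ : ∀ {x y L} → x ∈ remove y L → x ∈ L × x ≢ y
  ∈-remove⁻ {y = y} {L} = ∈-filter⁻ (λ z → ¬? (z ≟ y)) {xs = L}

  unique-remove : ∀ {x L} → Unique L → Unique (remove x L)
  unique-remove {x} = filter⁺ (λ z → ¬? (z ≟ x))

  length-remove : ∀ {x L} → Unique L → x ∈ L → suc (length (remove x L)) ≡ length L
  length-remove {x} {y ∷ L} (y∉L ∷ _) (here refl) =
    cong (λ l → suc (length l))
         (trans (filter-reject (λ z → ¬? (z ≟ x)) (λ x≢x → x≢x refl))
                (filter-all (λ z → ¬? (z ≟ x)) (All.map (λ x≢z z≡x → x≢z (sym z≡x)) y∉L)))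
  length-remove {x} {y ∷ L} (y∉L ∷ uL) (there x∈L) =
    trans (cong (λ l → suc (length l)) (filter-accept (λ z → ¬? (z ≟ x)) (All.lookup y∉L x∈L)))
          (cong suc (length-remove uL x∈L))

module _ {n : ℕ} where

  transpose-matchˡ : ∀ (i j : Fin n) → transpose i j ⟨$⟩ʳ i ≡ j
  transpose-matchˡ i j with i ≟ i
  ... | yes _   = refl
  ... | no i≢i  = ⊥-elim (i≢i refl)

  transpose-matchʳ : ∀ (i j : Fin n) → transpose i j ⟨$⟩ʳ j ≡ i
  transpose-matchʳ i j with j ≟ i
  ... | yes j≡i = j≡i
  ... | no _ with j ≟ j
  ...   | yes _  = refl
  ...   | no j≢j = ⊥-elim (j≢j refl)

  transpose-other : ∀ {i j k : Fin n} → k ≢ i → k ≢ j → transpose i j ⟨$⟩ʳ k ≡ k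
  transpose-other {i} {j} {k} k≢i k≢j with k ≟ i
  ... | yes k≡i = ⊥-elim (k≢i k≡i)
  ... | no _ with k ≟ j
  ...   | yes k≡j = ⊥-elim (k≢j k≡j)
  ...   | no _    = refl

  transpose-moves : ∀ {i j : Fin n} → i ≢ j → transpose i j ⟨$⟩ʳ i ≢ i
  transpose-moves {i} {j} i≢j ti≡i = i≢j (sym (trans (sym (transpose-matchˡ i j)) ti≡i))

  permutation-injective : (π : Permutation′ n) → ∀ {x y} → π ⟨$⟩ʳ x ≡ π ⟨$⟩ʳ y → x ≡ y
  permutation-injective π e = trans (sym (inverseˡ π)) (trans (cong (π ⟨$⟩ˡ_) e) (inverseˡ π))

module _ {V : Set} {H : Graph V} (σ : Automorphism H) where

  aut-injective : ∀ {u v} → fun σ u ≡ fun σ v → u ≡ v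
  aut-injective {u} {v} e = trans (sym (inv-left σ u)) (trans (cong (inv σ) e) (inv-left σ v))

  fixed-by-image : ∀ {v w} → fun σ v ≡ w → w ≡ v ⊎ fun σ w ≡ w → fun σ v ≡ v
  fixed-by-image σv≡w (inj₁ w≡v)   = trans σv≡w w≡v
  fixed-by-image σv≡w (inj₂ σw≡w) = trans σv≡w (sym (aut-injective (trans σv≡w (sym σw≡w))))

  adj-fixed : ∀ {u} → fun σ u ≡ u → ∀ {v} → Adj H v u → Adj H (fun σ v) u
  adj-fixed {u} σu≡u {v} a = subst (Adj H (fun σ v)) σu≡u (proj₁ (preserves σ v u) a)

  nonadj-fixed : ∀ {u} → fun σ u ≡ u → ∀ {v} → ¬ Adj H v u → ¬ Adj H (fun σ v) u
  nonadj-fixed {u} σu≡u {v} ¬a a = ¬a (proj₂ (preserves σ v u) (subst (Adj H (fun σ v)) (sym σu≡u) a))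

  fixed-if-others-fixed : DecidableEquality V → ∀ {v} → (∀ w → w ≢ v → fun σ w ≡ w) → fun σ v ≡ v
  fixed-if-others-fixed _≟ᵥ_ {v} others with fun σ v ≟ᵥ v
  ... | yes σv≡v = σv≡v
  ... | no σv≢v  = fixed-by-image refl (inj₂ (others (fun σ v) σv≢v))

module _ {V : Set} (_≟ᵥ_ : DecidableEquality V) {H : Graph V} {S : List V} (fixing : IsFixingSet H S) where

  open DecMembership _≟ᵥ_ using (_∈?_)

  fixing-set-meets-support : (τ : Automorphism H) (supp : List V) → (∀ v → v ∉ supp → fun τ v ≡ v) →
                             ∀ {v} → fun τ v ≢ v → Any (_∈ S) supp
  fixing-set-meets-support τ supp outside {v} moved with Any.any? (_∈? S) supp
  ... | yes hit = hit
  ... | no miss = ⊥-elim (moved (fixing τ (λ w w∈S → outside w (λ w∈supp → miss (lose w∈supp w∈S))) v))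

-- Automorphisms of F_{K_n} induced by permutations intertwining g

module _ {n : ℕ} (g : Fin n → Fin n) where

  induced-automorphism : (π ρ : Permutation′ n) → (∀ a → g (π ⟨$⟩ʳ a) ≡ ρ ⟨$⟩ʳ (g a)) →
                         Automorphism (Functigraph (K n) g)
  induced-automorphism π ρ intertwines = record
    { fun = ⊎-map (π ⟨$⟩ʳ_) (ρ ⟨$⟩ʳ_) ; inv = ⊎-map (π ⟨$⟩ˡ_) (ρ ⟨$⟩ˡ_)
    ; inv-left = left ; inv-right = right ; preserves = preserve }
    where
    left : ∀ v → ⊎-map (π ⟨$⟩ˡ_) (ρ ⟨$⟩ˡ_) (⊎-map (π ⟨$⟩ʳ_) (ρ ⟨$⟩ʳ_) v) ≡ v
    left (inj₁ a) = cong inj₁ (inverseˡ π)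
    left (inj₂ c) = cong inj₂ (inverseˡ ρ)
    right : ∀ v → ⊎-map (π ⟨$⟩ʳ_) (ρ ⟨$⟩ʳ_) (⊎-map (π ⟨$⟩ˡ_) (ρ ⟨$⟩ˡ_) v) ≡ v
    right (inj₁ a) = cong inj₁ (inverseʳ π)
    right (inj₂ c) = cong inj₂ (inverseʳ ρ)
    H = Functigraph (K n) g
    φ = ⊎-map (π ⟨$⟩ʳ_) (ρ ⟨$⟩ʳ_)
    preserve : ∀ u v → (Adj H u v → Adj H (φ u) (φ v)) × (Adj H (φ u) (φ v) → Adj H u v)
    preserve (inj₁ x) (inj₁ y) = (λ x≢y e → x≢y (permutation-injective π e)) , (λ πx≢πy e → πx≢πy (cong (π ⟨$⟩ʳ_) e))
    preserve (inj₂ x) (inj₂ y) = (λ x≢y e → x≢y (permutation-injective ρ e)) , (λ ρx≢ρy e → ρx≢ρy (cong (ρ ⟨$⟩ʳ_) e))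
    preserve (inj₁ a) (inj₂ c) = (λ ga≡c → trans (intertwines a) (cong (ρ ⟨$⟩ʳ_) ga≡c))
                               , (λ e → permutation-injective ρ (trans (sym (intertwines a)) e))
    preserve (inj₂ c) (inj₁ a) = (λ ga≡c → trans (intertwines a) (cong (ρ ⟨$⟩ʳ_) ga≡c))
                               , (λ e → permutation-injective ρ (trans (sym (intertwines a)) e))

  swap-in-fibre : ∀ {x y} → g x ≡ g y → ∀ a → g (transpose x y ⟨$⟩ʳ a) ≡ id ⟨$⟩ʳ (g a)
  swap-in-fibre {x} {y} gx≡gy a = by-cases (a ≟ x) (a ≟ y)
    where
    by-cases : Dec (a ≡ x) → Dec (a ≡ y) → g (transpose x y ⟨$⟩ʳ a) ≡ g a
    by-cases (yes refl) _          = trans (cong g (transpose-matchˡ a y)) (sym gx≡gy)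
    by-cases (no _)     (yes refl) = trans (cong g (transpose-matchʳ x a)) gx≡gy
    by-cases (no a≢x)   (no a≢y)   = cong g (transpose-other a≢x a≢y)

  swap-outside-image : ∀ {x y} → (∀ a → g a ≢ x) → (∀ a → g a ≢ y) →
                       ∀ a → g (id ⟨$⟩ʳ a) ≡ transpose x y ⟨$⟩ʳ (g a)
  swap-outside-image x∉ y∉ a = sym (transpose-other (x∉ a) (y∉ a))

  swap-singleton-fibres : ∀ {p q x y} → g p ≡ x → g q ≡ y → (∀ a → g a ≡ x → a ≡ p) → (∀ a → g a ≡ y → a ≡ q) →
                          ∀ a → g (transpose p q ⟨$⟩ʳ a) ≡ transpose x y ⟨$⟩ʳ (g a)
  swap-singleton-fibres {p} {q} {x} {y} gp≡x gq≡y only-p only-q a = by-cases (a ≟ p) (a ≟ q)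
    where
    open ≡-Reasoning
    by-cases : Dec (a ≡ p) → Dec (a ≡ q) → g (transpose p q ⟨$⟩ʳ a) ≡ transpose x y ⟨$⟩ʳ (g a)
    by-cases (yes refl) _ = begin
      g (transpose a q ⟨$⟩ʳ a) ≡⟨ cong g (transpose-matchˡ a q) ⟩
      g q                      ≡⟨ gq≡y ⟩
      y                        ≡⟨ transpose-matchˡ x y ⟨
      transpose x y ⟨$⟩ʳ x     ≡⟨ cong (transpose x y ⟨$⟩ʳ_) gp≡x ⟨
      transpose x y ⟨$⟩ʳ g a   ∎
    by-cases (no _) (yes refl) = begin
      g (transpose p a ⟨$⟩ʳ a) ≡⟨ cong g (transpose-matchʳ p a) ⟩
      g p                      ≡⟨ gp≡x ⟩
      x                        ≡⟨ transpose-matchʳ x y ⟨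
      transpose x y ⟨$⟩ʳ y     ≡⟨ cong (transpose x y ⟨$⟩ʳ_) gq≡y ⟨
      transpose x y ⟨$⟩ʳ g a   ∎
    by-cases (no a≢p) (no a≢q) =
      trans (cong g (transpose-other a≢p a≢q))
            (sym (transpose-other (λ ga≡x → a≢p (only-p a ga≡x)) (λ ga≡y → a≢q (only-q a ga≡y))))

-- Size of the fixing set: (n − 2) + (|B ∖ g(A)| − 1).
upper-arith : ∀ {n s a k} → suc (suc a) ≡ n → s + suc k ≡ n → a + k ≡ 2 * n ∸ (s + 3)
upper-arith {_} {s} {a} {k} refl sk≡n = sym (trans (cong (_∸ (s + 3)) twice-n) (m+n∸n≡m (a + k) (s + 3)))
  where
  double : ∀ m → 2 * m ≡ m + m
  double = solve-∀
  regroup : ∀ a s k → suc (suc a) + (s + suc k) ≡ (a + k) + (s + 3)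
  regroup = solve-∀
  twice-n : 2 * suc (suc a) ≡ (a + k) + (s + 3)
  twice-n = trans (double (suc (suc a))) (trans (cong (suc (suc a) +_) (sym sk≡n)) (regroup a s k))

-- From |g⁻¹(b)| ≥ n − s + 1 and |g(A) ∖ {b}| = s − 1: the two fill up n points.
fill-arith : ∀ {n s f o} → s ≤ n → suc o ≡ s → n ∸ s + 1 ≤ f → n ≤ f + o
fill-arith {n} {_} {f} {o} s≤n refl large = begin
  n                      ≡⟨ m∸n+n≡m s≤n ⟨
  n ∸ suc o + suc o      ≡⟨ +-suc _ o ⟩
  suc (n ∸ suc o) + o    ≡⟨ cong (_+ o) (+-comm 1 (n ∸ suc o)) ⟩
  (n ∸ suc o + 1) + o    ≤⟨ +-monoˡ-≤ o large ⟩
  f + o                  ∎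
  where open ≤-Reasoning

-- With |g⁻¹(b)| = f, |B ∖ g(A)| = c, |g(A) ∖ {b}| = o, a set of size x covering all but
-- one class of each kind satisfies f + c + o ≤ 3 + x, which forces x ≥ 2n − (s + 3).
lower-arith : ∀ {n s f c o x} → suc o ≡ s → s + c ≡ n → n ∸ s + 1 ≤ f → f + (c + o) ≤ 3 + x →
              2 * n ∸ (s + 3) ≤ x
lower-arith {_} {_} {f} {c} {o} {x} refl refl large covered = m≤n+o⇒m∸n≤o _ (suc o + 3) (begin
  2 * (suc o + c)               ≡⟨ regroup o c ⟩
  (c + 1) + (c + o) + suc o     ≤⟨ +-monoˡ-≤ (suc o) (+-monoˡ-≤ (c + o) c+1≤f) ⟩
  f + (c + o) + suc o           ≤⟨ +-monoˡ-≤ (suc o) covered ⟩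
  (3 + x) + suc o               ≡⟨ swap-ends x o ⟩
  (suc o + 3) + x               ∎)
  where
  open ≤-Reasoning
  regroup : ∀ o c → 2 * (suc o + c) ≡ (c + 1) + (c + o) + suc o
  regroup = solve-∀
  swap-ends : ∀ x o → (3 + x) + suc o ≡ (suc o + 3) + x
  swap-ends = solve-∀
  c+1≤f : c + 1 ≤ f
  c+1≤f = subst (λ m → m + 1 ≤ f) (m+n∸m≡n (suc o) c) large

module LargeFibre {n : ℕ} (g : Fin n → Fin n) (b : Fin n)
                  (large : n ∸ imageSize g + 1 ≤ fibreSize g b) where

  V : Set
  V = Fin n ⊎ Fin n

  H : Graph V
  H = Functigraph (K n) g

  _≟ᵥ_ : DecidableEquality V
  _≟ᵥ_ = ≡-dec _≟_ _≟_

  inImage? : (y : Fin n) → Dec (∃[ a ] g a ≡ y)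
  inImage? y = any? (λ a → g a ≟ y)

  Fibre Image Others Free : List (Fin n)
  Fibre  = filter (λ a → g a ≟ b) (allFin n)
  Image  = filter inImage? (allFin n)
  Others = remove _≟_ b Image
  Free   = filter (λ y → ¬? (inImage? y)) (allFin n)

  ∈Fibre : ∀ {a} → a ∈ Fibre → g a ≡ b
  ∈Fibre a∈ = proj₂ (∈-filter⁻ (λ a → g a ≟ b) {xs = allFin n} a∈)

  ∈Others : ∀ {y} → y ∈ Others → (∃[ a ] g a ≡ y) × y ≢ b
  ∈Others y∈ with ∈-remove⁻ _≟_ y∈
  ... | y∈Image , y≢b = proj₂ (∈-filter⁻ inImage? {xs = allFin n} y∈Image) , y≢b

  ∈Free : ∀ {c} → c ∈ Free → ∀ a → g a ≢ c
  ∈Free c∈ a ga≡c = proj₂ (∈-filter⁻ (λ y → ¬? (inImage? y)) {xs = allFin n} c∈) (a , ga≡c)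

  unique-Fibre : Unique Fibre
  unique-Fibre = filter⁺ (λ a → g a ≟ b) (allFin⁺ n)

  unique-Others : Unique Others
  unique-Others = unique-remove _≟_ (filter⁺ inImage? (allFin⁺ n))

  unique-Free : Unique Free
  unique-Free = filter⁺ (λ y → ¬? (inImage? y)) (allFin⁺ n)

  length-allFin : length (allFin n) ≡ n
  length-allFin = length-tabulate (λ x → x)

  -- |g(A)| + |B ∖ g(A)| = n and |g(A) ∖ {b}| = |g(A)| − 1 (b is an image point).
  image-free-split : imageSize g + length Free ≡ n
  image-free-split = trans (length-filter-split inImage? (allFin n)) length-allFin

  length-Others : suc (length Others) ≡ imageSize g
  length-Others with some-member Fibre (≤-trans (m≤n+m 1 (n ∸ imageSize g)) large)
  ... | a , a∈ = length-remove _≟_ (filter⁺ inImage? (allFin⁺ n)) (∈-filter⁺ inImage? (∈-allFin b) (a , ∈Fibre a∈))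

  pre : Fin n → Fin n
  pre y with inImage? y
  ... | yes (a , _) = a
  ... | no _        = y

  pre-spec : ∀ {y} → ∃[ a ] g a ≡ y → g (pre y) ≡ y
  pre-spec {y} in-image with inImage? y
  ... | yes (_ , ga≡y) = ga≡y
  ... | no ∉image      = ⊥-elim (∉image in-image)

  PreimageList : List (Fin n)
  PreimageList = Fibre ++ map pre Others

  unique-PreimageList : Unique PreimageList
  unique-PreimageList = ++⁺ unique-Fibre (map-unique-on pre pre-injective unique-Others) disjoint
    where
    pre-injective : ∀ {x y} → x ∈ Others → y ∈ Others → pre x ≡ pre y → x ≡ y
    pre-injective x∈ y∈ e = trans (sym (pre-spec (proj₁ (∈Others x∈)))) (trans (cong g e) (pre-spec (proj₁ (∈Others y∈))))
    disjoint : ∀ {a} → ¬ (a ∈ Fibre × a ∈ map pre Others)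
    disjoint (a∈F , a∈pre) with ∈-map⁻ pre a∈pre
    ... | y , y∈ , refl = proj₂ (∈Others y∈) (trans (sym (pre-spec (proj₁ (∈Others y∈)))) (∈Fibre a∈F))

  length-PreimageList : n ≤ length PreimageList
  length-PreimageList = begin
    n                                 ≤⟨ fill-arith image≤n length-Others large ⟩
    length Fibre + length Others      ≡⟨ cong (length Fibre +_) (length-map pre Others) ⟨
    length Fibre + length (map pre Others) ≡⟨ length-++ Fibre ⟨
    length PreimageList               ∎
    where
    open ≤-Reasoning
    image≤n : imageSize g ≤ n
    image≤n = ≤-trans (length-filter inImage? (allFin n)) (≤-reflexive length-allFin)

  -- Every fibre other than g⁻¹(b) is a singleton: PreimageList already exhausts A.
  pre-unique : ∀ a → g a ≢ b → pre (g a) ≡ a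
  pre-unique a ga≢b with pre (g a) ≟ a
  ... | yes pre≡a = pre≡a
  ... | no pre≢a  = ⊥-elim (<-irrefl refl (begin-strict
      n                               ≤⟨ length-PreimageList ⟩
      length PreimageList             <⟨ n<1+n _ ⟩
      length (a ∷ PreimageList)       ≤⟨ unique-⊆-length (All.tabulate a-new ∷ unique-PreimageList) (λ {x} _ → ∈-allFin x) ⟩
      length (allFin n)               ≡⟨ length-allFin ⟩
      n                               ∎))
    where
    open ≤-Reasoning
    a-new : ∀ {v} → v ∈ PreimageList → a ≢ v
    a-new v∈ refl with ∈-++⁻ Fibre v∈
    ... | inj₁ a∈F = ga≢b (∈Fibre a∈F)
    ... | inj₂ a∈pre with ∈-map⁻ pre a∈pre
    ...   | y , y∈ , refl = pre≢a (cong pre (pre-spec (proj₁ (∈Others y∈))))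

  only-preimage : ∀ {y} → y ∈ Others → ∀ a → g a ≡ y → a ≡ pre y
  only-preimage y∈ a refl = sym (pre-unique a (proj₂ (∈Others y∈)))

  -- Lower bound.  A twin class is a set of vertices that an automorphism can exchange
  -- with another class of the same kind while fixing everything else.

  data TwinClass : Set where
    fibreVertex : Fin n → TwinClass
    freeVertex  : Fin n → TwinClass
    matchedPair : Fin n → TwinClass

  part : TwinClass → List V
  part (fibreVertex a) = inj₁ a ∷ []
  part (freeVertex c)  = inj₂ c ∷ []
  part (matchedPair y) = inj₁ (pre y) ∷ inj₂ y ∷ []

  IsClass : TwinClass → Set
  IsClass (fibreVertex a) = g a ≡ b
  IsClass (freeVertex c)  = ∀ a → g a ≢ c
  IsClass (matchedPair y) = (∃[ a ] g a ≡ y) × y ≢ b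

  -- the class containing a vertex (on vertices outside every class the value is irrelevant)
  classOf : V → TwinClass
  classOf (inj₁ a) with g a ≟ b
  ... | yes _ = fibreVertex a
  ... | no _  = matchedPair (g a)
  classOf (inj₂ c) with inImage? c
  ... | yes _ = matchedPair c
  ... | no _  = freeVertex c

  classOf-part : ∀ x → IsClass x → ∀ {v} → v ∈ part x → classOf v ≡ x
  classOf-part (fibreVertex a) ga≡b (here refl) with g a ≟ b
  ... | yes _  = refl
  ... | no ga≢b = ⊥-elim (ga≢b ga≡b)
  classOf-part (freeVertex c) c-free (here refl) with inImage? c
  ... | yes (a , ga≡c) = ⊥-elim (c-free a ga≡c)
  ... | no _           = refl
  classOf-part (matchedPair y) (in-image , y≢b) (here refl) with g (pre y) ≟ b
  ... | yes gpre≡b = ⊥-elim (y≢b (trans (sym (pre-spec in-image)) gpre≡b))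
  ... | no _       = cong matchedPair (pre-spec in-image)
  classOf-part (matchedPair y) (in-image , _) (there (here refl)) with inImage? y
  ... | yes _        = refl
  ... | no ∉image    = ⊥-elim (∉image in-image)

  Classes : List TwinClass
  Classes = map fibreVertex Fibre ++ (map freeVertex Free ++ map matchedPair Others)

  Classes-are-classes : ∀ {x} → x ∈ Classes → IsClass x
  Classes-are-classes x∈ with ∈-++⁻ (map fibreVertex Fibre) x∈
  ... | inj₁ p with ∈-map⁻ fibreVertex p
  ...   | _ , a∈ , refl = ∈Fibre a∈
  Classes-are-classes x∈ | inj₂ q with ∈-++⁻ (map freeVertex Free) q
  ... | inj₁ p with ∈-map⁻ freeVertex p
  ...   | _ , c∈ , refl = ∈Free c∈
  Classes-are-classes x∈ | inj₂ q | inj₂ p with ∈-map⁻ matchedPair p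
  ...   | _ , y∈ , refl = ∈Others y∈

  unique-Classes : Unique Classes
  unique-Classes =
    ++⁺ (map⁺ (λ { refl → refl }) unique-Fibre)
        (++⁺ (map⁺ (λ { refl → refl }) unique-Free) (map⁺ (λ { refl → refl }) unique-Others) free-vs-pair)
        fibre-vs-rest
    where
    free-vs-pair : ∀ {x} → ¬ (x ∈ map freeVertex Free × x ∈ map matchedPair Others)
    free-vs-pair (p , q) with ∈-map⁻ freeVertex p | ∈-map⁻ matchedPair q
    ... | _ , _ , refl | _ , _ , ()
    fibre-vs-rest : ∀ {x} → ¬ (x ∈ map fibreVertex Fibre × x ∈ map freeVertex Free ++ map matchedPair Others)
    fibre-vs-rest (p , q) with ∈-map⁻ fibreVertex p | ∈-++⁻ (map freeVertex Free) q
    ... | _ , _ , refl | inj₁ q′ with ∈-map⁻ freeVertex q′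
    ...   | _ , _ , ()
    fibre-vs-rest (p , q) | _ , _ , refl | inj₂ q′ with ∈-map⁻ matchedPair q′
    ...   | _ , _ , ()

  unique-class-vertices : Unique (concatMap part Classes)
  unique-class-vertices =
    concatMap-unique part classOf (λ {x} x∈ → classOf-part x (Classes-are-classes x∈)) unique-part unique-Classes
    where
    unique-part : ∀ {x} → x ∈ Classes → Unique (part x)
    unique-part {fibreVertex _} _ = [] ∷ []
    unique-part {freeVertex _}  _ = [] ∷ []
    unique-part {matchedPair _} _ = ((λ ()) ∷ []) ∷ [] ∷ []

  open DecMembership _≟ᵥ_ using (_∈?_)

  Covered : List V → TwinClass → Set
  Covered S x = Any (_∈ S) (part x)

  covered? : (S : List V) → Decidable (Covered S)
  covered? S x = Any.any? (_∈? S) (part x)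

  covered-classes-bound : ∀ S → length (filter (covered? S) Classes) ≤ length S
  covered-classes-bound S =
    ≤-trans (count-parts (_∈? S) part Classes)
            (unique-⊆-length (filter⁺ (_∈? S) unique-class-vertices)
                             (λ v∈ → proj₂ (∈-filter⁻ (_∈? S) {xs = concatMap part Classes} v∈)))

  covered-classes-split : ∀ S → length (filter (covered? S) Classes) ≡
    length (filter (λ a → covered? S (fibreVertex a)) Fibre) +
    (length (filter (λ c → covered? S (freeVertex c)) Free) + length (filter (λ y → covered? S (matchedPair y)) Others))
  covered-classes-split S = begin
    length (filter (covered? S) Classes)
      ≡⟨ length-filter-++ (covered? S) (map fibreVertex Fibre) _ ⟩
    length (filter (covered? S) (map fibreVertex Fibre)) + length (filter (covered? S) (map freeVertex Free ++ map matchedPair Others))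
      ≡⟨ cong (length (filter (covered? S) (map fibreVertex Fibre)) +_) (length-filter-++ (covered? S) (map freeVertex Free) _) ⟩
    length (filter (covered? S) (map fibreVertex Fibre)) +
      (length (filter (covered? S) (map freeVertex Free)) + length (filter (covered? S) (map matchedPair Others)))
      ≡⟨ cong₂ _+_ (length-filter-map (covered? S) fibreVertex Fibre)
                   (cong₂ _+_ (length-filter-map (covered? S) freeVertex Free)
                              (length-filter-map (covered? S) matchedPair Others)) ⟩
    _ ∎
    where open ≡-Reasoning

  Exchange : TwinClass → TwinClass → Set
  Exchange x y = Σ (Automorphism H) λ τ → (∀ v → v ∉ part x ++ part y → fun τ v ≡ v) × ∃[ v ] fun τ v ≢ v

  exchange-covers : ∀ {S} → IsFixingSet H S → ∀ {x y} → Exchange x y → Covered S x ⊎ Covered S y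
  exchange-covers fixing {x} {y} (τ , outside , _ , moved) =
    Any.++⁻ (part x) (fixing-set-meets-support _≟ᵥ_ fixing τ (part x ++ part y) outside moved)

  fibre-exchange : ∀ {a a′} → a ∈ Fibre → a′ ∈ Fibre → a ≢ a′ → Exchange (fibreVertex a) (fibreVertex a′)
  fibre-exchange {a} {a′} a∈ a′∈ a≢a′ = τ , outside , inj₁ a , moved
    where
    τ = induced-automorphism g (transpose a a′) id (swap-in-fibre g (trans (∈Fibre a∈) (sym (∈Fibre a′∈))))
    outside : ∀ v → v ∉ inj₁ a ∷ inj₁ a′ ∷ [] → fun τ v ≡ v
    outside (inj₁ x) v∉ = cong inj₁ (transpose-other (λ { refl → v∉ (here refl) }) (λ { refl → v∉ (there (here refl)) }))
    outside (inj₂ _) _  = refl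
    moved : fun τ (inj₁ a) ≢ inj₁ a
    moved e = transpose-moves a≢a′ (inj₁-injective e)

  free-exchange : ∀ {c c′} → c ∈ Free → c′ ∈ Free → c ≢ c′ → Exchange (freeVertex c) (freeVertex c′)
  free-exchange {c} {c′} c∈ c′∈ c≢c′ = τ , outside , inj₂ c , moved
    where
    τ = induced-automorphism g id (transpose c c′) (swap-outside-image g (∈Free c∈) (∈Free c′∈))
    outside : ∀ v → v ∉ inj₂ c ∷ inj₂ c′ ∷ [] → fun τ v ≡ v
    outside (inj₁ _) _  = refl
    outside (inj₂ x) v∉ = cong inj₂ (transpose-other (λ { refl → v∉ (here refl) }) (λ { refl → v∉ (there (here refl)) }))
    moved : fun τ (inj₂ c) ≢ inj₂ c
    moved e = transpose-moves c≢c′ (inj₂-injective e)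

  pair-exchange : ∀ {y y′} → y ∈ Others → y′ ∈ Others → y ≢ y′ → Exchange (matchedPair y) (matchedPair y′)
  pair-exchange {y} {y′} y∈ y′∈ y≢y′ = τ , outside , inj₂ y , moved
    where
    τ = induced-automorphism g (transpose (pre y) (pre y′)) (transpose y y′)
          (swap-singleton-fibres g (pre-spec (proj₁ (∈Others y∈))) (pre-spec (proj₁ (∈Others y′∈)))
                                   (only-preimage y∈) (only-preimage y′∈))
    outside : ∀ v → v ∉ inj₁ (pre y) ∷ inj₂ y ∷ inj₁ (pre y′) ∷ inj₂ y′ ∷ [] → fun τ v ≡ v
    outside (inj₁ x) v∉ = cong inj₁ (transpose-other (λ { refl → v∉ (here refl) })
                                                      (λ { refl → v∉ (there (there (here refl))) }))
    outside (inj₂ x) v∉ = cong inj₂ (transpose-other (λ { refl → v∉ (there (here refl)) })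
                                                      (λ { refl → v∉ (there (there (there (here refl)))) }))
    moved : fun τ (inj₂ y) ≢ inj₂ y
    moved e = transpose-moves y≢y′ (inj₂-injective e)

  family-bound : ∀ {S} → IsFixingSet H S → (tag : Fin n → TwinClass) (L : List (Fin n)) → Unique L →
                 (∀ {x y} → x ∈ L → y ∈ L → x ≢ y → Exchange (tag x) (tag y)) →
                 length L ≤ suc (length (filter (λ x → covered? S (tag x)) L))
  family-bound fixing tag L uL exchange =
    pairwise-cover-length (λ x → covered? _ (tag x)) L uL (λ x∈ y∈ x≢y → exchange-covers fixing (exchange x∈ y∈ x≢y))

  lower-bound : ∀ S → IsFixingSet H S → 2 * n ∸ (imageSize g + 3) ≤ length S
  lower-bound S fixing = lower-arith length-Others image-free-split large (begin
    length Fibre + (length Free + length Others)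
      ≤⟨ +-mono-≤ (family-bound fixing fibreVertex Fibre unique-Fibre fibre-exchange)
                  (+-mono-≤ (family-bound fixing freeVertex Free unique-Free free-exchange)
                            (family-bound fixing matchedPair Others unique-Others pair-exchange)) ⟩
    suc x₁ + (suc x₂ + suc x₃)     ≡⟨ three-more x₁ x₂ x₃ ⟩
    3 + (x₁ + (x₂ + x₃))           ≡⟨ cong (3 +_) (covered-classes-split S) ⟨
    3 + length (filter (covered? S) Classes) ≤⟨ +-monoʳ-≤ 3 (covered-classes-bound S) ⟩
    3 + length S                   ∎)
    where
    open ≤-Reasoning
    x₁ = length (filter (λ a → covered? S (fibreVertex a)) Fibre)
    x₂ = length (filter (λ c → covered? S (freeVertex c)) Free)
    x₃ = length (filter (λ y → covered? S (matchedPair y)) Others)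
    three-more : ∀ x₁ x₂ x₃ → suc x₁ + (suc x₂ + suc x₃) ≡ 3 + (x₁ + (x₂ + x₃))
    three-more = solve-∀

  -- Upper bound: an explicit fixing set

  -- fs, f ∈ g⁻¹(b); bs, b′ ∈ g(A) ∖ {b} with preimages as, a′; cs ∈ B ∖ g(A).
  -- S = (A ∖ {fs, as}) ∪ ((B ∖ g(A)) ∖ {cs}).
  module UpperBound {fs f bs b′ cs : Fin n} (fs∈ : fs ∈ Fibre) (f∈ : f ∈ Fibre) (fs≢f : fs ≢ f)
                    (bs∈ : bs ∈ Others) (b′∈ : b′ ∈ Others) (bs≢b′ : bs ≢ b′) (cs∈ : cs ∈ Free) where

    as a′ : Fin n
    as = pre bs
    a′ = pre b′

    gfs : g fs ≡ b
    gfs = ∈Fibre fs∈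
    gf : g f ≡ b
    gf = ∈Fibre f∈
    gas : g as ≡ bs
    gas = pre-spec (proj₁ (∈Others bs∈))
    ga′ : g a′ ≡ b′
    ga′ = pre-spec (proj₁ (∈Others b′∈))
    bs≢b : bs ≢ b
    bs≢b = proj₂ (∈Others bs∈)
    b′≢b : b′ ≢ b
    b′≢b = proj₂ (∈Others b′∈)

    apart : ∀ {x y} → g x ≢ g y → x ≢ y
    apart gx≢gy refl = gx≢gy refl

    as≢fs : as ≢ fs
    as≢fs = apart (λ e → bs≢b (trans (sym gas) (trans e gfs)))

    SA SB : List (Fin n)
    SA = remove _≟_ as (remove _≟_ fs (allFin n))
    SB = remove _≟_ cs Free

    S : List V
    S = map inj₁ SA ++ map inj₂ SB

    S-unique : Unique S
    S-unique = ++⁺ (map⁺ inj₁-injective (unique-remove _≟_ (unique-remove _≟_ (allFin⁺ n))))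
                   (map⁺ inj₂-injective (unique-remove _≟_ unique-Free)) disjoint
      where
      disjoint : ∀ {v} → ¬ (v ∈ map inj₁ SA × v ∈ map inj₂ SB)
      disjoint (p , q) with ∈-map⁻ inj₁ p | ∈-map⁻ inj₂ q
      ... | _ , _ , refl | _ , _ , ()

    S-length : length S ≡ 2 * n ∸ (imageSize g + 3)
    S-length = begin
      length S                   ≡⟨ length-++ (map inj₁ SA) ⟩
      length (map inj₁ SA) + length (map inj₂ SB) ≡⟨ cong₂ _+_ (length-map inj₁ SA) (length-map inj₂ SB) ⟩
      length SA + length SB      ≡⟨ upper-arith A-count B-count ⟩
      2 * n ∸ (imageSize g + 3)  ∎
      where
      open ≡-Reasoning
      A-count : suc (suc (length SA)) ≡ n
      A-count = trans (cong suc (length-remove _≟_ (unique-remove _≟_ (allFin⁺ n)) (∈-remove⁺ _≟_ (∈-allFin as) as≢fs)))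
                      (trans (length-remove _≟_ (allFin⁺ n) (∈-allFin fs)) length-allFin)
      B-count : imageSize g + suc (length SB) ≡ n
      B-count = trans (cong (imageSize g +_) (length-remove _≟_ unique-Free cs∈)) image-free-split

    module Forced (σ : Automorphism H) (fixes-S : ∀ v → v ∈ S → fun σ v ≡ v) where

      A-in-S-fixed : ∀ {a} → a ≢ fs → a ≢ as → fun σ (inj₁ a) ≡ inj₁ a
      A-in-S-fixed {a} a≢fs a≢as =
        fixes-S (inj₁ a) (∈-++⁺ˡ (∈-map⁺ inj₁ (∈-remove⁺ _≟_ (∈-remove⁺ _≟_ (∈-allFin a) a≢fs) a≢as)))

      free-in-S-fixed : ∀ {c} → c ∈ Free → c ≢ cs → fun σ (inj₂ c) ≡ inj₂ c
      free-in-S-fixed c∈ c≢cs = fixes-S (inj₂ _) (∈-++⁺ʳ (map inj₁ SA) (∈-map⁺ inj₂ (∈-remove⁺ _≟_ c∈ c≢cs)))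

      f-fixed : fun σ (inj₁ f) ≡ inj₁ f
      f-fixed = A-in-S-fixed (λ f≡fs → fs≢f (sym f≡fs)) (apart (λ e → bs≢b (trans (sym gas) (trans (sym e) gf))))

      a′-fixed : fun σ (inj₁ a′) ≡ inj₁ a′
      a′-fixed = A-in-S-fixed (apart (λ e → b′≢b (trans (sym ga′) (trans e gfs))))
                         (apart (λ e → bs≢b′ (trans (sym gas) (trans (sym e) ga′))))

      -- b is the only vertex adjacent to f but not to a′ that is not fixed already.
      b-fixed : fun σ (inj₂ b) ≡ inj₂ b
      b-fixed = fixed-by-image σ refl
        (candidates _ (adj-fixed σ f-fixed gf) (nonadj-fixed σ a′-fixed (λ ga′≡b → b′≢b (trans (sym ga′) ga′≡b))))
        where
        candidates : ∀ w → Adj H w (inj₁ f) → ¬ Adj H w (inj₁ a′) → w ≡ inj₂ b ⊎ fun σ w ≡ w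
        candidates (inj₂ y) gf≡y _    = inj₁ (cong inj₂ (trans (sym gf≡y) gf))
        candidates (inj₁ x) _ x≁a′ with decidable-stable (x ≟ a′) x≁a′
        ... | refl = inj₂ a′-fixed

      -- the neighbours of f and b that are not yet fixed: only fs
      fs-fixed : fun σ (inj₁ fs) ≡ inj₁ fs
      fs-fixed = fixed-by-image σ refl (candidates _ (adj-fixed σ f-fixed fs≢f) (adj-fixed σ b-fixed gfs))
        where
        candidates : ∀ w → Adj H w (inj₁ f) → Adj H w (inj₂ b) → w ≡ inj₁ fs ⊎ fun σ w ≡ w
        candidates (inj₂ y) gf≡y y≢b = ⊥-elim (y≢b (trans (sym gf≡y) gf))
        candidates (inj₁ x) _ gx≡b with x ≟ fs
        ... | yes refl = inj₁ refl
        ... | no x≢fs  = inj₂ (A-in-S-fixed x≢fs (apart (λ e → bs≢b (trans (sym gas) (trans (sym e) gx≡b)))))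

      -- the neighbours of f that are not yet fixed: only as
      as-fixed : fun σ (inj₁ as) ≡ inj₁ as
      as-fixed = fixed-by-image σ refl
        (candidates _ (adj-fixed σ f-fixed (apart (λ e → bs≢b (trans (sym gas) (trans e gf))))))
        where
        candidates : ∀ w → Adj H w (inj₁ f) → w ≡ inj₁ as ⊎ fun σ w ≡ w
        candidates (inj₂ y) gf≡y with trans (sym gf≡y) gf
        ... | refl = inj₂ b-fixed
        candidates (inj₁ x) _ with x ≟ as | x ≟ fs
        ... | yes refl | _        = inj₁ refl
        ... | no _     | yes refl = inj₂ fs-fixed
        ... | no x≢as  | no x≢fs  = inj₂ (A-in-S-fixed x≢fs x≢as)

      A-fixed : ∀ a → fun σ (inj₁ a) ≡ inj₁ a
      A-fixed a with a ≟ fs | a ≟ as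
      ... | yes refl | _        = fs-fixed
      ... | no _     | yes refl = as-fixed
      ... | no a≢fs  | no a≢as  = A-in-S-fixed a≢fs a≢as

      -- g a is the only B-neighbour of the fixed vertex a.
      image-fixed : ∀ a → fun σ (inj₂ (g a)) ≡ inj₂ (g a)
      image-fixed a = fixed-by-image σ refl (candidates _ (adj-fixed σ (A-fixed a) refl))
        where
        candidates : ∀ w → Adj H w (inj₁ a) → w ≡ inj₂ (g a) ⊎ fun σ w ≡ w
        candidates (inj₂ z) ga≡z = inj₁ (cong inj₂ (sym ga≡z))
        candidates (inj₁ x) _    = inj₂ (A-fixed x)

      fixed-except-cs : ∀ w → w ≢ inj₂ cs → fun σ w ≡ w
      fixed-except-cs (inj₁ a) _ = A-fixed a
      fixed-except-cs (inj₂ c) w≢cs with inImage? c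
      ... | yes (a , refl) = image-fixed a
      ... | no ∉image      = free-in-S-fixed (∈-filter⁺ (λ y → ¬? (inImage? y)) (∈-allFin c) ∉image) (λ { refl → w≢cs refl })

      all-fixed : ∀ v → fun σ v ≡ v
      all-fixed v with v ≟ᵥ inj₂ cs
      ... | yes refl = fixed-if-others-fixed σ _≟ᵥ_ fixed-except-cs
      ... | no v≢cs  = fixed-except-cs v v≢cs

    S-fixing : IsFixingSet H S
    S-fixing σ fixes-S = Forced.all-fixed σ fixes-S

  upper-bound : 2 < imageSize g → imageSize g < n →
                ∃[ S ] (Unique S × IsFixingSet H S × length S ≡ 2 * n ∸ (imageSize g + 3))
  upper-bound 2<s s<n with two-members Fibre unique-Fibre two-in-fibre
                         | two-members Others unique-Others two-others
                         | some-member Free one-free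
    where
    two-in-fibre : 2 ≤ length Fibre
    two-in-fibre = ≤-trans (+-monoˡ-≤ 1 (m<n⇒0<n∸m s<n)) large
    two-others : 2 ≤ length Others
    two-others = s≤s⁻¹ (subst (3 ≤_) (sym length-Others) 2<s)
    one-free : 1 ≤ length Free
    one-free = +-cancelˡ-≤ (imageSize g) 1 (length Free)
                 (≤-trans (subst (_≤ n) (+-comm 1 (imageSize g)) s<n) (≤-reflexive (sym image-free-split)))
  ... | fs , f , fs∈ , f∈ , fs≢f | bs , b′ , bs∈ , b′∈ , bs≢b′ | cs , cs∈ =
    S , S-unique , S-fixing , S-length
    where open UpperBound fs∈ f∈ fs≢f bs∈ b′∈ bs≢b′ cs∈

mainTheorem10 : (n : ℕ) → 3 ≤ n → (g : Fin n → Fin n) → (s : ℕ) → imageSize g ≡ s →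
    2 < s → s < n → ∃[ b ] (n ∸ s + 1 ≤ fibreSize g b) →
    FixNumber (Functigraph (K n) g) (2 * n ∸ (s + 3))
mainTheorem10 n _ g _ refl 2<s s<n (b , large) =
  upper-bound 2<s s<n , λ S _ fixing → lower-bound S fixing
  where open LargeFibre g b large
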